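{- Let $\Sigma$ be a set and $\delta\colon S\to\mathcal{P}(S\times\mathbb{N})^\Sigma$ a labelled transition system with rewards. If $\{\mathcal{A}_n\}_{n\in\mathbb{N}}$ is a graded bisimulation on $\delta$, then $\bigcup_{n\in\mathbb{N}}\mathcal{A}_n$ is an ungraded bisimulation on $\delta$.
   Context: $\mathcal{P}$ is the covariant powerset functor; $(s',n)\in\delta(s)(a)$ means a transition $s\xrightarrow{a}s'$ with reward $n$. For a relation $R$ on a set $X$, let $\hat F(R)$ be the relation on $\mathcal{P}(X\times\mathbb{N})^\Sigma$ consisting of pairs $(\tau_0,\tau_1)$ such that for all $i\in\{0,1\}$, $a\in\Sigma$ and $(x_i,r_i)\in\tau_i(a)$ there is $(x_{1-i},r_{1-i})\in\tau_{1-i}(a)$ with $(x_0,x_1)\in R$. For an $\mathbb{N}$-indexed family $\mathcal{A}=\{\mathcal{A}_n\}$ of relations on $X$, let $\hat F^{\mathbb{N}}(\mathcal{A})_n$ be the set of pairs $(\tau_0,\tau_1)$ such that for all $i\in\{0,1\}$, $a\in\Sigma$, $(x_i,r_i)\in\tau_i(a)$ there is $(x_{1-i},r_{1-i})\in\tau_{1-i}(a)$ with $r_0\le n+r_1$ and $(x_0,x_1)\in\mathcal{A}_{n-r_0+r_1}$. An ungraded bisimulation on $\delta$ is $R\subseteq S\times S$ with $(\delta(s),\delta(s'))\in\hat F(R)$ for all $(s,s')\in R$; a graded bisimulation on $\delta$ is a family $\{\mathcal{A}_n\}_{n\in\mathbb{N}}$ of relations on $S$ with $(\delta(s),\delta(s'))\in\hat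 F^{\mathbb{N}}(\mathcal{A})_n$ for all $n$ and $(s,s')\in\mathcal{A}_n$. -}

module Defs where

open import Level using (Level; _⊔_; suc)
open import Data.Nat using (ℕ; _+_; _∸_; _≤_)
open import Data.Product using (Σ; ∃; _×_; _,_)

𝒫 : ∀ {ℓ} → Set ℓ → Set (suc ℓ)
𝒫 {ℓ} A = A → Set ℓ

Rel : ∀ {ℓ} → Set ℓ → Set (suc ℓ)
Rel {ℓ} X = X → X → Set ℓ

-- Labelled transition system with rewards: δ : S → 𝒫(S × ℕ)^Σ.
-- (s' , n) ∈ δ s a  means  s --a--> s' with reward n.
LTSR : ∀ {ℓ} → Set ℓ → Set ℓ → Set (suc ℓ)
LTSR Σl S = S → Σl → 𝒫 (S × ℕ)

-- F̂(R): both directions of the transfer condition (i = 0 and i = 1 written out).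
Fhat : ∀ {ℓ} {Σl X : Set ℓ} → Rel X → (Σl → 𝒫 (X × ℕ)) → (Σl → 𝒫 (X × ℕ)) → Set ℓ
Fhat {Σl = Σl} {X} R τ₀ τ₁ =
  ((a : Σl) (x₀ : X) (r₀ : ℕ) → τ₀ a (x₀ , r₀) →
     Σ X λ x₁ → Σ ℕ λ r₁ → τ₁ a (x₁ , r₁) × R x₀ x₁)
  × ((a : Σl) (x₁ : X) (r₁ : ℕ) → τ₁ a (x₁ , r₁) →
     Σ X λ x₀ → Σ ℕ λ r₀ → τ₀ a (x₀ , r₀) × R x₀ x₁)

-- F̂^ℕ(𝒜)_n : index n - r₀ + r₁ computed as (n + r₁) ∸ r₀, legitimate since r₀ ≤ n + r₁.
FhatN : ∀ {ℓ} {Σl X : Set ℓ} → (ℕ → Rel X) → ℕ → (Σl → 𝒫 (X × ℕ)) → (Σl → 𝒫 (X × ℕ)) → Set ℓ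
FhatN {Σl = Σl} {X} 𝒜 n τ₀ τ₁ =
  ((a : Σl) (x₀ : X) (r₀ : ℕ) → τ₀ a (x₀ , r₀) →
     Σ X λ x₁ → Σ ℕ λ r₁ → τ₁ a (x₁ , r₁) × (r₀ ≤ n + r₁) × 𝒜 ((n + r₁) ∸ r₀) x₀ x₁)
  × ((a : Σl) (x₁ : X) (r₁ : ℕ) → τ₁ a (x₁ , r₁) →
     Σ X λ x₀ → Σ ℕ λ r₀ → τ₀ a (x₀ , r₀) × (r₀ ≤ n + r₁) × 𝒜 ((n + r₁) ∸ r₀) x₀ x₁)

IsUngradedBisim : ∀ {ℓ} {Σl S : Set ℓ} → LTSR Σl S → Rel S → Set ℓ
IsUngradedBisim {S = S} δ R = (s s' : S) → R s s' → Fhat R (δ s) (δ s')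

IsGradedBisim : ∀ {ℓ} {Σl S : Set ℓ} → LTSR Σl S → (ℕ → Rel S) → Set ℓ
IsGradedBisim {S = S} δ 𝒜 = (n : ℕ) (s s' : S) → 𝒜 n s s' → FhatN 𝒜 n (δ s) (δ s')

⋃ℕ : ∀ {ℓ} {X : Set ℓ} → (ℕ → Rel X) → Rel X
⋃ℕ 𝒜 x y = Σ ℕ λ n → 𝒜 n x y

{-# OPTIONS --safe #-}
module Submission where

open import Defs
open import Data.Nat using (ℕ; _+_; _∸_)
open import Data.Product using (_×_; _,_)

FhatN⇒Fhat-⋃ℕ : ∀ {ℓ} {Σl X : Set ℓ} {𝒜 : ℕ → Rel X} {n : ℕ} {τ₀ τ₁ : Σl → 𝒫 (X × ℕ)} →
  FhatN 𝒜 n τ₀ τ₁ → Fhat (⋃ℕ 𝒜) τ₀ τ₁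
FhatN⇒Fhat-⋃ℕ {n = n} (forth , back) =
    (λ a x₀ r₀ τ₀x₀ → let x₁ , r₁ , τ₁x₁ , _ , x₀𝒜x₁ = forth a x₀ r₀ τ₀x₀
                      in x₁ , r₁ , τ₁x₁ , ((n + r₁) ∸ r₀ , x₀𝒜x₁))
  , (λ a x₁ r₁ τ₁x₁ → let x₀ , r₀ , τ₀x₀ , _ , x₀𝒜x₁ = back a x₁ r₁ τ₁x₁
                      in x₀ , r₀ , τ₀x₀ , ((n + r₁) ∸ r₀ , x₀𝒜x₁))

proposition6 : ∀ {ℓ} (Σl S : Set ℓ) (δ : LTSR Σl S) (𝒜 : ℕ → Rel S) →
    IsGradedBisim δ 𝒜 → IsUngradedBisim δ (⋃ℕ 𝒜)
proposition6 Σl S δ 𝒜 graded s s' (n , s𝒜ₙs') = FhatN⇒Fhat-⋃ℕ (graded n s s' s𝒜ₙs')
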